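{- Let $G$ be a LUCS graph such that $N_G$ is an independent set. Then $G[N(v)]$ is $P_3$-free for every vertex $v\in N_G$. Additionally, if $K\subseteq V(G)\setminus N_G$ is a clique such that $|N(v)\cap K|\ge 2$ for some $v\in N_G$, then $v$ is adjacent to every vertex of $K$.
   Context: A graph is complete split if its vertex set can be partitioned into a clique $K$ and a maximum independent set $S$ with every vertex of $K$ adjacent to every vertex of $S$; $(K,S)$ is a complete split partition. $G$ is LUCS if for every vertex $v$, every connected component of $G[N(v)]$ is complete split. For a vertex $w$ and a connected component $C_w$ of $G[N(w)]$ with complete split partition $(K_{C_w},S_{C_w})$, $F_G$ is the set of non-edges $uv$ of $G$ with $u,v\in S_{C_w}$ for some vertex $w$ and some such component $C_w$; $N_G$ is the set of all endpoints of pairs in $F_G$. (For LUCS graphs, $N_G$ is exactly the set of vertices that are tips, i.e. nonadjacent vertices, of some induced diamond $K_4-e$.) -}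

module Defs where

open import Data.Nat using (ℕ; _≤_)
open import Data.Bool using (Bool; true; false)
open import Data.Fin using (Fin)
open import Data.Fin.Subset using (Subset; _∈_; _∉_; _⊆_; _∩_; ∣_∣)
open import Data.Vec using (tabulate)
open import Data.Product using (Σ; ∃; _×_; _,_)
open import Data.Sum using (_⊎_)
open import Relation.Binary.PropositionalEquality using (_≡_; _≢_)
open import Relation.Nullary using (¬_)

record Graph (n : ℕ) : Set where
  field
    E     : Fin n → Fin n → Bool
    E-sym : ∀ u v → E u v ≡ E v u
    loopless : ∀ v → E v v ≡ false
open Graph public

module _ {n : ℕ} (G : Graph n) where

  Adj : Fin n → Fin n → Set
  Adj u v = E G u v ≡ true

  Nbh : Fin n → Subset n
  Nbh v = tabulate (λ u → E G v u)

  -- X is a clique / an independent set of G (hence of any induced subgraph)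
  IsClique : Subset n → Set
  IsClique X = ∀ u v → u ∈ X → v ∈ X → u ≢ v → Adj u v

  IsIndependent : Subset n → Set
  IsIndependent X = ∀ u v → u ∈ X → v ∈ X → ¬ Adj u v

  data PathIn (X : Subset n) : Fin n → Fin n → Set where
    here : ∀ {u} → u ∈ X → PathIn X u u
    step : ∀ {u w v} → u ∈ X → Adj u w → PathIn X w v → PathIn X u v

  IsComponentOf : Subset n → Subset n → Set
  IsComponentOf C X =
      C ⊆ X
    × (∃ λ u → u ∈ C)
    × (∀ u v → u ∈ C → v ∈ C → PathIn C u v)
    × (∀ u v → u ∈ C → v ∈ X → Adj u v → v ∈ C)

  IsCompleteSplitPartition : Subset n → Subset n → Subset n → Set
  IsCompleteSplitPartition C K S =
      (∀ u → u ∈ C → (u ∈ K) × (u ∉ S) ⊎ (u ∉ K) × (u ∈ S))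
    × K ⊆ C × S ⊆ C
    × IsClique K
    × IsIndependent S
    × (∀ T → T ⊆ C → IsIndependent T → ∣ T ∣ ≤ ∣ S ∣)
    × (∀ u v → u ∈ K → v ∈ S → Adj u v)

  IsCompleteSplit : Subset n → Set
  IsCompleteSplit C = ∃ λ K → ∃ λ S → IsCompleteSplitPartition C K S

  LUCS : Set
  LUCS = ∀ v C → IsComponentOf C (Nbh v) → IsCompleteSplit C

  InF : Fin n → Fin n → Set
  InF u v = ∃ λ w → ∃ λ C → ∃ λ K → ∃ λ S →
      IsComponentOf C (Nbh w) × IsCompleteSplitPartition C K S
    × u ∈ S × v ∈ S × u ≢ v × ¬ Adj u v

  InNG : Fin n → Set
  InNG u = ∃ λ v → InF u v ⊎ InF v u

  NG-independent : Set
  NG-independent = ∀ u v → InNG u → InNG v → ¬ Adj u v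

  P3-freeIn : Subset n → Set
  P3-freeIn X = ∀ a b c → a ∈ X → b ∈ X → c ∈ X →
    Adj a b → Adj b c → a ≢ c → Adj a c

-- If a – b – c is an induced P₃ in G[N(w)], then a, b, c lie in one component C
-- of G[N(w)], and in a complete split partition (K , S) of C every vertex of K is
-- adjacent to all other vertices of C; so the non-adjacent a and c both lie in S
-- and ac ∈ F_G.  In other words, the two tips of an induced diamond form a pair
-- of F_G.  An induced P₃ a – b – c in N(v) is a diamond with spine v b and tips
-- a, c, so for v ∈ N_G it would put the neighbour a of v into N_G.  If v sees two
-- vertices y, z of a clique K but not x ∈ K, then v and x are the tips of a
-- diamond with spine y z, forcing x ∈ N_G.
module Submission where

open import Defs
open import Data.Nat using (ℕ; _≤_; s≤s)
open import Data.Bool using (true)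
import Data.Bool.Properties as Bool
open import Data.Fin using (Fin; zero; suc)
open import Data.Fin.Properties using (any?; suc-injective; _≟_)
open import Data.Fin.Subset
  using (Subset; _∈_; _∉_; _⊆_; _⊃_; _∩_; _∪_; ∣_∣; ⁅_⁆; Nonempty; inside; outside)
open import Data.Fin.Subset.Properties
  using (_∈?_; p⊆p∪q; q⊆p∪q; x∈p∪q⁻; x∈⁅x⁆; x∈⁅y⁆⇒x≡y; x∈p∩q⁻)
open import Data.Fin.Subset.Induction using (Acc; acc; ⊃-wellFounded)
open import Data.Vec using (_∷_)
open import Data.Vec.Base using (here; there)
open import Data.Vec.Properties using (lookup∘tabulate; []=⇒lookup; lookup⇒[]=)
open import Data.Product using (∃; ∃₂; _×_; _,_)
import Data.Product as Product
open import Data.Sum using (_⊎_; inj₁; inj₂)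
import Data.Sum as Sum
open import Function using (_∘_)
open import Relation.Binary.PropositionalEquality using (_≡_; _≢_; refl; sym; trans; subst)
open import Relation.Nullary using (¬_; Dec; yes; no; contradiction)
open import Relation.Nullary.Decidable using (_×-dec_; ¬?; decidable-stable)

1≤∣p∣⇒Nonempty : ∀ {n} (p : Subset n) → 1 ≤ ∣ p ∣ → Nonempty p
1≤∣p∣⇒Nonempty (inside ∷ p) _ = zero , here
1≤∣p∣⇒Nonempty (outside ∷ p) 1≤∣p∣ = Product.map suc there (1≤∣p∣⇒Nonempty p 1≤∣p∣)

2≤∣p∣⇒distinct-pair : ∀ {n} (p : Subset n) → 2 ≤ ∣ p ∣ → ∃₂ λ y z → y ≢ z × y ∈ p × z ∈ p
2≤∣p∣⇒distinct-pair (inside ∷ p) (s≤s 1≤∣p∣) =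
  let z , z∈p = 1≤∣p∣⇒Nonempty p 1≤∣p∣
  in zero , suc z , (λ ()) , here , there z∈p
2≤∣p∣⇒distinct-pair (outside ∷ p) 2≤∣p∣ =
  let y , z , y≢z , y∈p , z∈p = 2≤∣p∣⇒distinct-pair p 2≤∣p∣
  in suc y , suc z , y≢z ∘ suc-injective , there y∈p , there z∈p

∈∪⁅⁆⁻ : ∀ {n} {C : Subset n} {v x} → x ∈ C ∪ ⁅ v ⁆ → x ∈ C ⊎ x ≡ v
∈∪⁅⁆⁻ {C = C} {v} = Sum.map₂ (x∈⁅y⁆⇒x≡y v) ∘ x∈p∪q⁻ C ⁅ v ⁆

module _ {n : ℕ} (G : Graph n) where

  Adj? : ∀ u v → Dec (Adj G u v)
  Adj? u v = E G u v Bool.≟ true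

  Adj-sym : ∀ {u v} → Adj G u v → Adj G v u
  Adj-sym {u} {v} uv = trans (E-sym G v u) uv

  ∈Nbh⇒Adj : ∀ {v u} → u ∈ Nbh G v → Adj G v u
  ∈Nbh⇒Adj {v} {u} u∈N = trans (sym (lookup∘tabulate (E G v) u)) ([]=⇒lookup u∈N)

  Adj⇒∈Nbh : ∀ {v u} → Adj G v u → u ∈ Nbh G v
  Adj⇒∈Nbh {v} {u} vu = lookup⇒[]= u _ (trans (lookup∘tabulate (E G v) u) vu)

  PathIn-mono : ∀ {S T u v} → S ⊆ T → PathIn G S u v → PathIn G T u v
  PathIn-mono S⊆T (here u∈S) = here (S⊆T u∈S)
  PathIn-mono S⊆T (step u∈S uw p) = step (S⊆T u∈S) uw (PathIn-mono S⊆T p)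

  PathIn-∪ˡ : ∀ {S} T {u v} → PathIn G S u v → PathIn G (S ∪ T) u v
  PathIn-∪ˡ T = PathIn-mono (p⊆p∪q T)

  PathIn-++ : ∀ {S u w v} → PathIn G S u w → PathIn G S w v → PathIn G S u v
  PathIn-++ (here _) q = q
  PathIn-++ (step u∈S uw p) q = step u∈S uw (PathIn-++ p q)

  Connected : Subset n → Set
  Connected C = ∀ u v → u ∈ C → v ∈ C → PathIn G C u v

  ⁅⁆-connected : ∀ a → Connected ⁅ a ⁆
  ⁅⁆-connected a u v u∈ v∈ with x∈⁅y⁆⇒x≡y a u∈ | x∈⁅y⁆⇒x≡y a v∈
  ... | refl | refl = here u∈

  ∪⁅⁆-connected : ∀ {C u v} → Connected C → u ∈ C → Adj G u v → Connected (C ∪ ⁅ v ⁆)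
  ∪⁅⁆-connected {C} {u} {v} C-conn u∈C uv x y x∈ y∈ with ∈∪⁅⁆⁻ x∈ | ∈∪⁅⁆⁻ y∈
  ... | inj₁ x∈C | inj₁ y∈C = PathIn-∪ˡ ⁅ v ⁆ (C-conn x y x∈C y∈C)
  ... | inj₁ x∈C | inj₂ refl =
    PathIn-++ (PathIn-∪ˡ ⁅ v ⁆ (C-conn x u x∈C u∈C)) (step (p⊆p∪q ⁅ v ⁆ u∈C) uv (here y∈))
  ... | inj₂ refl | inj₁ y∈C = step x∈ (Adj-sym uv) (PathIn-∪ˡ ⁅ v ⁆ (C-conn u y u∈C y∈C))
  ... | inj₂ refl | inj₂ refl = here x∈

  LeavingEdge : Subset n → Subset n → Set
  LeavingEdge X C = ∃₂ λ u v → u ∈ C × v ∈ X × v ∉ C × Adj G u v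

  leavingEdge? : ∀ X C → Dec (LeavingEdge X C)
  leavingEdge? X C = any? λ u → any? λ v →
    u ∈? C ×-dec v ∈? X ×-dec ¬? (v ∈? C) ×-dec Adj? u v

  module _ {X : Subset n} {a : Fin n} where

    grow-component : ∀ C → Acc _⊃_ C → C ⊆ X → a ∈ C → Connected C →
                     ∃ λ D → IsComponentOf G D X × a ∈ D
    grow-component C (acc larger) C⊆X a∈C C-conn with leavingEdge? X C
    ... | no no-exit = C , (C⊆X , (a , a∈C) , C-conn , closed) , a∈C
      where
        closed : ∀ u v → u ∈ C → v ∈ X → Adj G u v → v ∈ C
        closed u v u∈C v∈X uv =
          decidable-stable (v ∈? C) λ v∉C → no-exit (u , v , u∈C , v∈X , v∉C , uv)
    ... | yes (u , v , u∈C , v∈X , v∉C , uv) =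
      grow-component (C ∪ ⁅ v ⁆) (larger C∪⁅v⁆⊃C) C∪⁅v⁆⊆X (p⊆p∪q ⁅ v ⁆ a∈C)
                     (∪⁅⁆-connected C-conn u∈C uv)
      where
        C∪⁅v⁆⊃C : (C ∪ ⁅ v ⁆) ⊃ C
        C∪⁅v⁆⊃C = p⊆p∪q ⁅ v ⁆ , v , q⊆p∪q C ⁅ v ⁆ (x∈⁅x⁆ v) , v∉C
        C∪⁅v⁆⊆X : C ∪ ⁅ v ⁆ ⊆ X
        C∪⁅v⁆⊆X x∈ with ∈∪⁅⁆⁻ x∈
        ... | inj₁ x∈C = C⊆X x∈C
        ... | inj₂ refl = v∈X

    component-containing : a ∈ X → ∃ λ C → IsComponentOf G C X × a ∈ C
    component-containing a∈X =
      grow-component ⁅ a ⁆ (⊃-wellFounded ⁅ a ⁆) ⁅a⁆⊆X (x∈⁅x⁆ a) (⁅⁆-connected a)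
      where
        ⁅a⁆⊆X : ⁅ a ⁆ ⊆ X
        ⁅a⁆⊆X x∈ = subst (_∈ X) (sym (x∈⁅y⁆⇒x≡y a x∈)) a∈X

  nonadjacent⇒∈S : ∀ {C K S u v} → IsCompleteSplitPartition G C K S →
                   u ∈ C → v ∈ C → u ≢ v → ¬ Adj G u v → u ∈ S
  nonadjacent⇒∈S {u = u} {v} (partition , _ , _ , K-clique , _ , _ , K-S-adjacent) u∈C v∈C u≢v ¬uv
    with partition u u∈C | partition v v∈C
  ... | inj₂ (_ , u∈S) | _ = u∈S
  ... | inj₁ (u∈K , _) | inj₁ (v∈K , _) = contradiction (K-clique u v u∈K v∈K u≢v) ¬uv
  ... | inj₁ (u∈K , _) | inj₂ (_ , v∈S) = contradiction (K-S-adjacent u v u∈K v∈S) ¬uv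

  diamond-tips∈F : LUCS G → ∀ {y z u v} →
                   Adj G y z → Adj G y u → Adj G z u → Adj G y v → Adj G z v →
                   u ≢ v → ¬ Adj G u v → InF G u v
  diamond-tips∈F lucs {y} {z} {u} {v} yz yu zu yv zv u≢v ¬uv
    with component-containing (Adj⇒∈Nbh yu)
  ... | C , C-component@(_ , _ , _ , C-closed) , u∈C with lucs y C C-component
  ... | K , S , split = y , C , K , S , C-component , split , u∈S , v∈S , u≢v , ¬uv
    where
      v∈C : v ∈ C
      v∈C = C-closed z v (C-closed u z u∈C (Adj⇒∈Nbh yz) (Adj-sym zu)) (Adj⇒∈Nbh yv) zv
      u∈S : u ∈ S
      u∈S = nonadjacent⇒∈S split u∈C v∈C u≢v ¬uv
      v∈S : v ∈ S
      v∈S = nonadjacent⇒∈S split v∈C u∈C (u≢v ∘ sym) (¬uv ∘ Adj-sym)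

  NG-neighbourhood-P3-free : LUCS G → NG-independent G → ∀ {v} → InNG G v → P3-freeIn G (Nbh G v)
  NG-neighbourhood-P3-free lucs NG-indep {v} v∈NG a b c a∈N b∈N c∈N ab bc a≢c =
    decidable-stable (Adj? a c) λ ¬ac →
      NG-indep v a v∈NG (c , inj₁ (tips∈F ¬ac)) (∈Nbh⇒Adj a∈N)
    where
      tips∈F : ¬ Adj G a c → InF G a c
      tips∈F = diamond-tips∈F lucs (∈Nbh⇒Adj b∈N) (∈Nbh⇒Adj a∈N) (Adj-sym ab)
                                    (∈Nbh⇒Adj c∈N) bc a≢c

  two-clique-neighbours⇒Adj : LUCS G → ∀ {K y z v x} → IsClique G K →
                              y ∈ K → z ∈ K → y ≢ z → Adj G v y → Adj G v z →
                              x ∈ K → ¬ InNG G x → v ≢ x → Adj G v x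
  two-clique-neighbours⇒Adj lucs {y = y} {z} {v} {x} K-clique y∈K z∈K y≢z vy vz x∈K x∉NG v≢x
    with x ≟ y | x ≟ z
  ... | yes refl | _ = vy
  ... | no _ | yes refl = vz
  ... | no x≢y | no x≢z = decidable-stable (Adj? v x) λ ¬vx →
    x∉NG (v , inj₂ (diamond-tips∈F lucs (K-clique y z y∈K z∈K y≢z)
                                        (Adj-sym vy) (Adj-sym vz)
                                        (K-clique y x y∈K x∈K (x≢y ∘ sym))
                                        (K-clique z x z∈K x∈K (x≢z ∘ sym))
                                        v≢x ¬vx))

lemma6 : ∀ (n : ℕ) (G : Graph n) → LUCS G → NG-independent G →
    (∀ v → InNG G v → P3-freeIn G (Nbh G v))
    × (∀ (K : Subset n) (v : Fin n) → IsClique G K →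
        (∀ x → x ∈ K → ¬ InNG G x) → InNG G v →
        2 ≤ ∣ Nbh G v ∩ K ∣ → ∀ x → x ∈ K → Adj G v x)
lemma6 n G lucs NG-indep = (λ v → NG-neighbourhood-P3-free G lucs NG-indep) , clique-part
  where
    clique-part : ∀ (K : Subset n) (v : Fin n) → IsClique G K →
                  (∀ x → x ∈ K → ¬ InNG G x) → InNG G v →
                  2 ≤ ∣ Nbh G v ∩ K ∣ → ∀ x → x ∈ K → Adj G v x
    clique-part K v K-clique K-avoids-NG v∈NG two x x∈K
      with 2≤∣p∣⇒distinct-pair (Nbh G v ∩ K) two
    ... | y , z , y≢z , y∈ , z∈ with x∈p∩q⁻ (Nbh G v) K y∈ | x∈p∩q⁻ (Nbh G v) K z∈
    ... | y∈N , y∈K | z∈N , z∈K =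
      two-clique-neighbours⇒Adj G lucs K-clique y∈K z∈K y≢z (∈Nbh⇒Adj G y∈N) (∈Nbh⇒Adj G z∈N)
                                x∈K (K-avoids-NG x x∈K) λ { refl → K-avoids-NG x x∈K v∈NG }
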